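{- The integrality gap of the Weak-Tree-LP relaxation of the robust $s$-$t$ path problem on series-parallel graphs is $\Omega(k)$, where $k$ is the number of agents: there are instances in which the Weak-Tree-LP is feasible for a guess $\mathsf{GS}$ while every $s$-$t$ path $\mathcal{P}$ has $\max_{i\in[k]}c_i(\mathcal{P})\ge \Omega(k)\cdot\mathsf{GS}$.
   Context: Robust $s$-$t$ path: given a directed graph with vertices $s,t$ and cost functions $c_i:E\to\mathbb{R}_{\ge0}$, $i\in[k]$, minimize $\max_i c_i(\mathcal{P})$ over $s$-$t$ paths $\mathcal{P}$. A series-parallel graph (source $s$, sink $t$) is a single edge or is obtained from two series-parallel graphs by series composition (identify the sink of the first with the source of the second) or parallel composition (identify sources and sinks). Its decomposition tree $\mathbf{T}=(\mathbf{V},\mathbf{E})$ with root $\mathbf{r}$ has leaves corresponding bijectively to edges, internal nodes that are series or parallel nodes (indicating series resp. parallel composition of the children's subgraphs), children of a parallel node being leaves or series nodes and children of a series node being leaves or parallel nodes. Let $f_i(\mathbf{v})=c_i(e)$ for the leaf $\mathbf{v}$ corresponding to edge $e$ and $f_i(\mathbf{v})=0$ for internal nodes. For a guess $\mathsf{GS}>0$, first delete every edge $e$ with $c_i(e)>\mathsf{GS}$ for some $i$; the Weak-Tree-LP on the decomposition tree of the remaining graph asks for $x\in\mathbb{R}^{\mathbf{V}}_{\ge0}$ with $\sum_{\mathbf{u}\in\mathbf{V}}x_{\mathbf{u}}f_i(\mathbf{u})\le \mathsf{GS}\cdot x_{\mathbf{r}}$ for all $i\in[k]$, $x_{\mathbf{r}}=1$,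 $\sum_{\mathbf{u}\in\mathrm{child}(\mathbf{v})}x_{\mathbf{u}}=x_{\mathbf{v}}$ for every parallel node $\mathbf{v}$, and $x_{\mathbf{u}}=x_{\mathbf{v}}$ for every series node $\mathbf{v}$ and child $\mathbf{u}$. The integrality gap is the supremum over instances of the ratio between the optimal integral value and the smallest $\mathsf{GS}$ for which the Weak-Tree-LP is feasible. -}

module Defs where

open import Data.Nat using (ℕ)
open import Data.Fin using (Fin)
open import Data.List using (List; []; _∷_; length)
open import Data.List.Relation.Unary.All using (All; []; _∷_)
open import Data.Integer using (+_)
open import Data.Rational using (ℚ; 0ℚ; 1ℚ; _+_; _*_; _≤_; _<_; _/_)
open import Data.Product using (_×_; _,_; Σ; ∃)
open import Data.Unit using (⊤)
open import Data.Empty using (⊥)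
open import Relation.Binary.PropositionalEquality using (_≡_)

ℕ→ℚ : ℕ → ℚ
ℕ→ℚ n = (+ n) / 1

-- Decomposition trees of series-parallel graphs with k cost functions.
-- A leaf is an edge e, carrying its cost vector (c_1(e),...,c_k(e)).

data SPTree (k : ℕ) : Set where
  leaf : (Fin k → ℚ) → SPTree k
  ser  : List (SPTree k) → SPTree k
  par  : List (SPTree k) → SPTree k

IsSer : ∀ {k} → SPTree k → Set
IsSer (ser _) = ⊤
IsSer _       = ⊥

IsPar : ∀ {k} → SPTree k → Set
IsPar (par _) = ⊤
IsPar _       = ⊥

NotSer : ∀ {k} → SPTree k → Set
NotSer (ser _) = ⊥
NotSer _       = ⊤

NotPar : ∀ {k} → SPTree k → Set
NotPar (par _) = ⊥
NotPar _       = ⊤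

data WF {k : ℕ} : SPTree k → Set where
  wf-leaf : ∀ {c} → (∀ i → 0ℚ ≤ c i) → WF (leaf c)
  wf-ser  : ∀ {ts} → 2 Data.Nat.≤ length ts → All NotSer ts → All WF ts → WF (ser ts)
  wf-par  : ∀ {ts} → 2 Data.Nat.≤ length ts → All NotPar ts → All WF ts → WF (par ts)

-- Every edge e satisfies c_i(e) ≤ GS for all i (so deleting edges with
-- some c_i(e) > GS removes nothing).
AllEdgesBelow : ∀ {k} → ℚ → SPTree k → Set
AllEdgesBelowL : ∀ {k} → ℚ → List (SPTree k) → Set
AllEdgesBelow GS (leaf c) = ∀ i → c i ≤ GS
AllEdgesBelow GS (ser ts) = AllEdgesBelowL GS ts
AllEdgesBelow GS (par ts) = AllEdgesBelowL GS ts
AllEdgesBelowL GS []       = ⊤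
AllEdgesBelowL GS (t ∷ ts) = AllEdgesBelow GS t × AllEdgesBelowL GS ts

-- s-t paths of the series-parallel graph represented by a tree:
-- an edge is its own unique s-t path; an s-t path through a series
-- composition is the concatenation of an s-t path in each part; an s-t
-- path through a parallel composition is an s-t path in exactly one part.

data Path {k : ℕ} : SPTree k → Set
data SerPaths {k : ℕ} : List (SPTree k) → Set
data ParPath {k : ℕ} : List (SPTree k) → Set

data Path {k} where
  edgeP : ∀ {c} → Path (leaf c)
  serP  : ∀ {ts} → SerPaths ts → Path (ser ts)
  parP  : ∀ {ts} → ParPath ts → Path (par ts)

data SerPaths {k} where
  []  : SerPaths []
  _∷_ : ∀ {t ts} → Path t → SerPaths ts → SerPaths (t ∷ ts)

data ParPath {k} where
  here  : ∀ {t ts} → Path t → ParPath (t ∷ ts)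
  there : ∀ {t ts} → ParPath ts → ParPath (t ∷ ts)

pathCost : ∀ {k} {t : SPTree k} → Path t → Fin k → ℚ
serCost  : ∀ {k} {ts : List (SPTree k)} → SerPaths ts → Fin k → ℚ
parCost  : ∀ {k} {ts : List (SPTree k)} → ParPath ts → Fin k → ℚ
pathCost {t = leaf c} edgeP i = c i
pathCost (serP ps) i = serCost ps i
pathCost (parP p)  i = parCost p i
serCost [] i = 0ℚ
serCost (p ∷ ps) i = pathCost p i + serCost ps i
parCost (here p)  i = pathCost p i
parCost (there p) i = parCost p i

-- Weak-Tree-LP.  A vector x ∈ ℚ^V is represented as an annotation of
-- every node of the tree by a rational number.

data Ann {k : ℕ} : SPTree k → Set where
  leafA : ∀ {c}  → ℚ → Ann (leaf c)
  serA  : ∀ {ts} → ℚ → All Ann ts → Ann (ser ts)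
  parA  : ∀ {ts} → ℚ → All Ann ts → Ann (par ts)

val : ∀ {k} {t : SPTree k} → Ann t → ℚ
val (leafA q)   = q
val (serA q _)  = q
val (parA q _)  = q

sumVals : ∀ {k} {ts : List (SPTree k)} → All Ann ts → ℚ
sumVals []       = 0ℚ
sumVals (a ∷ as) = val a + sumVals as

-- Σ_u x_u f_i(u)  (f_i(u) = c_i(e) on leaves, 0 on internal nodes)
lpCost  : ∀ {k} {t : SPTree k} → Ann t → Fin k → ℚ
lpCostL : ∀ {k} {ts : List (SPTree k)} → All Ann ts → Fin k → ℚ
lpCost {t = leaf c} (leafA q) i = q * c i
lpCost (serA _ as) i = lpCostL as i
lpCost (parA _ as) i = lpCostL as i
lpCostL []       i = 0ℚ
lpCostL (a ∷ as) i = lpCost a i + lpCostL as i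

SerEq : ∀ {k} {ts : List (SPTree k)} → ℚ → All Ann ts → Set
SerEq q []       = ⊤
SerEq q (a ∷ as) = val a ≡ q × SerEq q as

LPStruct  : ∀ {k} {t : SPTree k} → Ann t → Set
LPStructL : ∀ {k} {ts : List (SPTree k)} → All Ann ts → Set
LPStruct (leafA q)   = 0ℚ ≤ q
LPStruct (serA q as) = 0ℚ ≤ q × LPStructL as × SerEq q as
LPStruct (parA q as) = 0ℚ ≤ q × LPStructL as × sumVals as ≡ q
LPStructL []       = ⊤
LPStructL (a ∷ as) = LPStruct a × LPStructL as

WeakTreeLPFeasible : ∀ {k} → SPTree k → ℚ → Set
WeakTreeLPFeasible {k} t GS =
  Σ (Ann t) λ x → LPStruct x × val x ≡ 1ℚ × (∀ (i : Fin k) → lpCost x i ≤ GS * val x)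

{-# OPTIONS --safe #-}
module Submission where

-- Take k parallel branches, branch a being a path of k edges each of which
-- costs 1 for agent a and 0 for everybody else.  An s-t path runs through a
-- whole branch, so the agent of that branch pays k.  Spreading the LP value
-- evenly, x = 1/k on every branch and edge, agent a pays k · (1/k) = 1 on its
-- own branch and nothing elsewhere, so the Weak-Tree-LP is feasible for GS = 1.

open import Defs
open import Data.Nat using (ℕ)
open import Data.Fin using (Fin)
open import Data.Product using (_×_; Σ; ∃)
open import Data.Rational using (ℚ; 0ℚ; _<_; _≤_; _*_)

open import Data.Nat as ℕ using (zero; suc; s≤s; z≤n)
open import Data.Fin using (zero; suc)
import Data.Nat.Properties as ℕP
import Data.Integer as ℤ
import Data.Integer.Properties as ℤP
open import Data.Rational using (1ℚ; _+_; 1/_; toℚᵘ; NonZero; Positive)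
open import Data.Rational.Properties
import Data.Rational.Unnormalised as ℚᵘ
import Data.Rational.Unnormalised.Properties as ℚᵘP
open import Data.List using (length; tabulate)
open import Data.List.Properties using (length-tabulate)
open import Data.List.Relation.Unary.All.Properties using (tabulate⁺)
open import Data.Product using (_,_; map₂)
open import Data.Unit using (tt)
open import Relation.Binary.PropositionalEquality
open import Algebra.Properties.Monoid.Sum +-0-monoid using (sum-cong-≗; sum-replicate-zero; sum-syntax)

private
  variable
    k n : ℕ

0<1 : 0ℚ < 1ℚ
0<1 = positive⁻¹ 1ℚ

0≤1 : 0ℚ ≤ 1ℚ
0≤1 = <⇒≤ 0<1

ℕ→ℚ-suc : ∀ n → ℕ→ℚ (suc n) ≡ 1ℚ + ℕ→ℚ n
ℕ→ℚ-suc n = toℚᵘ-injective (begin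
  toℚᵘ (ℕ→ℚ (suc n))            ≈⟨ toℚᵘ-fromℚᵘ (ℚᵘ.mkℚᵘ (ℤ.+ suc n) 0) ⟩
  ℚᵘ.mkℚᵘ (ℤ.+ suc n) 0         ≈⟨ mkℚᵘ-suc ⟩
  ℚᵘ.1ℚᵘ ℚᵘ.+ ℚᵘ.mkℚᵘ (ℤ.+ n) 0  ≈⟨ ℚᵘP.+-congʳ ℚᵘ.1ℚᵘ (ℚᵘP.≃-sym (toℚᵘ-fromℚᵘ (ℚᵘ.mkℚᵘ (ℤ.+ n) 0))) ⟩
  toℚᵘ 1ℚ ℚᵘ.+ toℚᵘ (ℕ→ℚ n)     ≈⟨ ℚᵘP.≃-sym (toℚᵘ-homo-+ 1ℚ (ℕ→ℚ n)) ⟩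
  toℚᵘ (1ℚ + ℕ→ℚ n)             ∎)
  where
  open ℚᵘP.≃-Reasoning
  mkℚᵘ-suc : ℚᵘ.mkℚᵘ (ℤ.+ suc n) 0 ℚᵘ.≃ ℚᵘ.1ℚᵘ ℚᵘ.+ ℚᵘ.mkℚᵘ (ℤ.+ n) 0
  mkℚᵘ-suc rewrite ℕP.*-identityʳ n | ℤP.+◃n≡+n n = ℚᵘ.*≡* refl

∑-const : ∀ n r → ∑[ _ < n ] r ≡ ℕ→ℚ n * r
∑-const zero    r = sym (*-zeroˡ r)
∑-const (suc n) r = begin
  r + ∑[ _ < n ] r       ≡⟨ cong₂ _+_ (sym (*-identityˡ r)) (∑-const n r) ⟩
  1ℚ * r + ℕ→ℚ n * r     ≡⟨ sym (*-distribʳ-+ r 1ℚ (ℕ→ℚ n)) ⟩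
  (1ℚ + ℕ→ℚ n) * r       ≡⟨ cong (_* r) (sym (ℕ→ℚ-suc n)) ⟩
  ℕ→ℚ (suc n) * r        ∎
  where open ≡-Reasoning

δ : Fin n → Fin n → ℚ
δ zero    zero    = 1ℚ
δ zero    (suc _) = 0ℚ
δ (suc _) zero    = 0ℚ
δ (suc a) (suc b) = δ a b

δ-diag : (a : Fin n) → δ a a ≡ 1ℚ
δ-diag zero    = refl
δ-diag (suc a) = δ-diag a

δ-nonNeg : (a b : Fin n) → 0ℚ ≤ δ a b
δ-nonNeg zero    zero    = 0≤1
δ-nonNeg zero    (suc _) = ≤-refl
δ-nonNeg (suc _) zero    = ≤-refl
δ-nonNeg (suc a) (suc b) = δ-nonNeg a b

δ≤1 : (a b : Fin n) → δ a b ≤ 1ℚ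
δ≤1 zero    zero    = ≤-refl
δ≤1 zero    (suc _) = 0≤1
δ≤1 (suc _) zero    = 0≤1
δ≤1 (suc a) (suc b) = δ≤1 a b

∑-δ : (b : Fin n) → ∑[ a < n ] δ a b ≡ 1ℚ
∑-δ {suc n} zero = begin
  1ℚ + ∑[ _ < n ] 0ℚ    ≡⟨ cong (1ℚ +_) (sum-replicate-zero n) ⟩
  1ℚ + 0ℚ               ≡⟨ +-identityʳ 1ℚ ⟩
  1ℚ                    ∎
  where open ≡-Reasoning
∑-δ {suc n} (suc b) = trans (+-identityˡ _) (∑-δ b)

allEdgesBelow-tabulate : {f : Fin n → SPTree k} {GS : ℚ} →
                         (∀ a → AllEdgesBelow GS (f a)) → AllEdgesBelowL GS (tabulate f)
allEdgesBelow-tabulate {n = zero}  below = tt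
allEdgesBelow-tabulate {n = suc n} below = below zero , allEdgesBelow-tabulate (λ a → below (suc a))

lpStruct-tabulate : {f : Fin n → SPTree k} {x : ∀ a → Ann (f a)} →
                    (∀ a → LPStruct (x a)) → LPStructL (tabulate⁺ x)
lpStruct-tabulate {n = zero}  st = tt
lpStruct-tabulate {n = suc n} st = st zero , lpStruct-tabulate (λ a → st (suc a))

serEq-tabulate : {f : Fin n → SPTree k} {q : ℚ} {x : ∀ a → Ann (f a)} →
                 (∀ a → val (x a) ≡ q) → SerEq q (tabulate⁺ x)
serEq-tabulate {n = zero}  eq = tt
serEq-tabulate {n = suc n} eq = eq zero , serEq-tabulate (λ a → eq (suc a))

sumVals-tabulate : {f : Fin n → SPTree k} (x : ∀ a → Ann (f a)) →
                   sumVals (tabulate⁺ x) ≡ ∑[ a < n ] val (x a)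
sumVals-tabulate {n = zero}  x = refl
sumVals-tabulate {n = suc n} x = cong (val (x zero) +_) (sumVals-tabulate (λ a → x (suc a)))

lpCost-tabulate : {f : Fin n → SPTree k} (x : ∀ a → Ann (f a)) (i : Fin k) →
                  lpCostL (tabulate⁺ x) i ≡ ∑[ a < n ] lpCost (x a) i
lpCost-tabulate {n = zero}  x i = refl
lpCost-tabulate {n = suc n} x i = cong (lpCost (x zero) i +_) (lpCost-tabulate (λ a → x (suc a)) i)

parPath-tabulate : {f : Fin n → SPTree k} (p : ParPath (tabulate f)) →
                   ∃ λ a → Σ (Path (f a)) λ P → ∀ i → parCost p i ≡ pathCost P i
parPath-tabulate {n = suc n} (here P)  = zero , P , λ i → refl
parPath-tabulate {n = suc n} (there p) with parPath-tabulate p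
... | a , P , cost = suc a , P , cost

serCost-edges : {c : Fin n → Fin k → ℚ} (ps : SerPaths (tabulate (λ e → leaf (c e)))) (i : Fin k) →
                serCost ps i ≡ ∑[ e < n ] c e i
serCost-edges {n = zero}          []           i = refl
serCost-edges {n = suc n} {c = c} (edgeP ∷ ps) i = cong (c zero i +_) (serCost-edges ps i)

module Gadget (k : ℕ) (2≤k : 2 ℕ.≤ k) where

  K : ℚ
  K = ℕ→ℚ k

  instance
    k-nonZero : ℕ.NonZero k
    k-nonZero = ℕ.>-nonZero (ℕP.<-≤-trans (s≤s z≤n) 2≤k)

    K-positive : Positive K
    K-positive = normalize-pos k 1

    K-nonZero : NonZero K
    K-nonZero = pos⇒nonZero K

  branch : Fin k → SPTree k
  branch a = ser (tabulate {n = k} λ _ → leaf (δ a))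

  gadget : SPTree k
  gadget = par (tabulate branch)

  gadget-WF : WF gadget
  gadget-WF = wf-par (length≥2 branch) (tabulate⁺ λ _ → tt) (tabulate⁺ branch-WF)
    where
    length≥2 : {A : Set} (g : Fin k → A) → 2 ℕ.≤ length (tabulate g)
    length≥2 g = subst (2 ℕ.≤_) (sym (length-tabulate g)) 2≤k

    branch-WF : ∀ a → WF (branch a)
    branch-WF a = wf-ser (length≥2 _) (tabulate⁺ λ _ → tt) (tabulate⁺ λ _ → wf-leaf (δ-nonNeg a))

  gadget-edgesBelow : AllEdgesBelow 1ℚ gadget
  gadget-edgesBelow = allEdgesBelow-tabulate λ a → allEdgesBelow-tabulate λ _ → δ≤1 a

  branchSpread : ∀ a → Ann (branch a)
  branchSpread a = serA (1/ K) (tabulate⁺ λ _ → leafA (1/ K))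

  spread : Ann gadget
  spread = parA 1ℚ (tabulate⁺ branchSpread)

  lpCost-branchSpread : ∀ a i → lpCost (branchSpread a) i ≡ δ a i
  lpCost-branchSpread a i = begin
    lpCost (branchSpread a) i  ≡⟨ lpCost-tabulate {f = λ (_ : Fin k) → leaf (δ a)} (λ _ → leafA (1/ K)) i ⟩
    ∑[ _ < k ] (1/ K * δ a i)  ≡⟨ ∑-const k _ ⟩
    K * (1/ K * δ a i)         ≡⟨ sym (*-assoc K (1/ K) _) ⟩
    K * 1/ K * δ a i           ≡⟨ cong (_* δ a i) (*-inverseʳ K) ⟩
    1ℚ * δ a i                 ≡⟨ *-identityˡ _ ⟩
    δ a i                      ∎
    where open ≡-Reasoning

  lpCost-spread : ∀ i → lpCost spread i ≡ 1ℚ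
  lpCost-spread i = begin
    lpCost spread i                        ≡⟨ lpCost-tabulate branchSpread i ⟩
    ∑[ a < k ] lpCost (branchSpread a) i   ≡⟨ sum-cong-≗ (λ a → lpCost-branchSpread a i) ⟩
    ∑[ a < k ] δ a i                       ≡⟨ ∑-δ i ⟩
    1ℚ                                     ∎
    where open ≡-Reasoning

  spread-LPStruct : LPStruct spread
  spread-LPStruct =
    0≤1 ,
    lpStruct-tabulate (λ _ → 0≤1/K , lpStruct-tabulate (λ _ → 0≤1/K) , serEq-tabulate (λ _ → refl)) ,
    trans (sumVals-tabulate branchSpread) (trans (∑-const k (1/ K)) (*-inverseʳ K))
    where
    0≤1/K : 0ℚ ≤ 1/ K
    0≤1/K = <⇒≤ (positive⁻¹ (1/ K) {{1/pos⇒pos K}})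

  feasible : WeakTreeLPFeasible gadget 1ℚ
  feasible = spread , spread-LPStruct , refl , λ i → ≤-reflexive (lpCost-spread i)

  pathCost≥K : (P : Path gadget) → ∃ λ i → K ≤ pathCost P i
  pathCost≥K (parP p) with parPath-tabulate p
  ... | a , serP ps , cost = a , ≤-reflexive (sym (begin
    parCost p a        ≡⟨ cost a ⟩
    serCost ps a       ≡⟨ serCost-edges ps a ⟩
    ∑[ _ < k ] δ a a   ≡⟨ ∑-const k _ ⟩
    K * δ a a          ≡⟨ cong (K *_) (δ-diag a) ⟩
    K * 1ℚ             ≡⟨ *-identityʳ K ⟩
    K                  ∎))
    where open ≡-Reasoning

lemmaA1 : Σ ℚ λ C → 0ℚ < C × Σ ℕ λ k₀ → (k : ℕ) → k₀ Data.Nat.≤ k →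
    Σ (SPTree k) λ T → Σ ℚ λ GS →
    WF T × 0ℚ < GS × AllEdgesBelow GS T × WeakTreeLPFeasible T GS ×
    ((P : Path T) → ∃ λ (i : Fin k) → C * ℕ→ℚ k * GS ≤ pathCost P i)
lemmaA1 = 1ℚ , 0<1 , 2 , λ k 2≤k → let open Gadget k 2≤k in
  gadget , 1ℚ , gadget-WF , 0<1 , gadget-edgesBelow , feasible ,
  λ P → map₂ (≤-trans (≤-reflexive (1*r*1≡r K))) (pathCost≥K P)
  where
  1*r*1≡r : ∀ r → 1ℚ * r * 1ℚ ≡ r
  1*r*1≡r r = trans (*-identityʳ _) (*-identityˡ r)
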